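{- Let $K = K(n) \ge 2$. In the worst case over $\sigma \in S_n$, the minimum number of duplication-loss steps of width at most $K$ needed to obtain $\sigma$ from $12\ldots n$ is $\Omega\left(\log n + \frac{n^2}{K^2}\right)$.
   Context: A duplication-loss step of width $k$ applied to a permutation $\pi$ chooses a contiguous fragment of $k$ consecutive positions and a subset $S$ of its entries, and replaces the fragment by the entries of $S$ in their original relative order followed by the remaining entries of the fragment in their original relative order. -}

module Defs where

open import Data.Nat using (ℕ; zero; suc; _+_; _≤_)
open import Data.Bool using (Bool; true; false; not)
open import Data.List using (List; []; _∷_; _++_; take; drop; length; map)
open import Data.Product using (Σ; _×_)
open import Relation.Binary.PropositionalEquality using (_≡_)

select : {A : Set} → List Bool → List A → List A
select [] _ = []
select (_ ∷ _) [] = []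
select (true ∷ bs) (x ∷ xs) = x ∷ select bs xs
select (false ∷ bs) (x ∷ xs) = select bs xs

-- the result of a duplication-loss step on π at (0-based) start position i,
-- fragment width k, subset of the fragment given by the mask b (length k):
-- entries of S in order, followed by the remaining entries in order
dlApply : List ℕ → ℕ → ℕ → List Bool → List ℕ
dlApply π i k b =
  take i π ++ (select b frag ++ (select (map not b) frag ++ drop (i + k) π))
  where
  frag = take k (drop i π)

DLStep : ℕ → List ℕ → List ℕ → Set
DLStep K π π' =
  Σ ℕ λ i → Σ ℕ λ k → Σ (List Bool) λ b →
    (k ≤ K) × (i + k ≤ length π) × (length b ≡ k) × (π' ≡ dlApply π i k b)

data DLSteps (K : ℕ) : ℕ → List ℕ → List ℕ → Set where
  done : ∀ {π} → DLSteps K zero π π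
  step : ∀ {m π π' σ} → DLStep K π π' → DLSteps K m π' σ → DLSteps K (suc m) π σ

-- The reversal n-1 … 1 0 needs many steps for two independent reasons.
-- A step only reorders entries inside one fragment of width k ≤ K, so it
-- changes the relative order of at most k² pairs: the number of inversions
-- grows by at most K² per step, while the reversal has about n²/2 of them.
-- The result of a step is the concatenation of four subsequences of the
-- previous permutation, so the number of ascending runs is multiplied by
-- at most 4 per step, while the identity has one run and the reversal n.
-- So m steps force m·K² ≥ n²/4 and 4^m ≥ n, which gives the constant 6.
module Submission where

open import Defs
open import Data.Nat using (ℕ; _+_; _*_; _≤_)
open import Data.Nat.Logarithm using (⌊log₂_⌋)
open import Data.List using (List; upTo)
open import Data.List.Relation.Binary.Permutation.Propositional using (_↭_)
open import Data.Product using (∃; _×_)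

open import Data.Nat using (zero; suc; _<_; _<?_; _^_; z≤n; s≤s)
open import Data.Nat.Properties
open import Data.Nat.ListAction using (sum)
open import Data.Nat.ListAction.Properties using (sum-++; sum-↭)
open import Data.Nat.Logarithm using (⌊log₂⌋-mono-≤; ⌊log₂[2^n]⌋≡n)
open import Data.Nat.Tactic.RingSolver using (solve-∀)
open import Data.Bool using (Bool; true; false; not)
open import Data.List using ([]; _∷_; _++_; take; drop; length; map; downFrom)
open import Data.List.Properties using (++-assoc; map-++; map-cong; take++drop≡id; drop-drop; length-take; reverse-upTo)
open import Data.List.Relation.Unary.All using (All; []; _∷_)
open import Data.List.Relation.Unary.AllPairs using (AllPairs; []; _∷_)
import Data.List.Relation.Unary.AllPairs.Properties as AllPairs
open import Data.List.Relation.Binary.Sublist.Propositional using (_⊆_; []; _∷_; _∷ʳ_; minimum; ⊆-trans)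
open import Data.List.Relation.Binary.Sublist.Propositional.Properties using (take-⊆; drop-⊆)
open import Data.List.Relation.Binary.Permutation.Propositional using (prep; ↭-trans; ↭-refl)
open import Data.List.Relation.Binary.Permutation.Propositional.Properties using (↭-length; ↭-reverse; map⁺; shift; ++⁺ʳ)
open import Data.Product using (_,_)
open import Function using (id)
open import Relation.Binary.PropositionalEquality
open import Relation.Nullary using (yes; no)
open import Data.Empty using (⊥-elim)

⟦_>_⟧ : ℕ → ℕ → ℕ
⟦ a > y ⟧ with y <? a
... | yes _ = 1
... | no _ = 0

⟦>⟧≤1 : ∀ a y → ⟦ a > y ⟧ ≤ 1
⟦>⟧≤1 a y with y <? a
... | yes _ = s≤s z≤n
... | no _ = z≤n

⟦>⟧-yes : ∀ {a y} → y < a → ⟦ a > y ⟧ ≡ 1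
⟦>⟧-yes {a} {y} y<a with y <? a
... | yes _ = refl
... | no y≮a = ⊥-elim (y≮a y<a)

⟦>⟧-no : ∀ {a y} → a ≤ y → ⟦ a > y ⟧ ≡ 0
⟦>⟧-no {a} {y} a≤y with y <? a
... | yes y<a = ⊥-elim (<⇒≱ y<a a≤y)
... | no _ = refl

⟦>⟧-trans : ∀ x y z → ⟦ x > z ⟧ ≤ ⟦ x > y ⟧ + ⟦ y > z ⟧
⟦>⟧-trans x y z with z <? x | y <? x | z <? y
... | no _ | _ | _ = z≤n
... | yes _ | yes _ | _ = s≤s z≤n
... | yes _ | no _ | yes _ = s≤s z≤n
... | yes z<x | no y≮x | no z≮y = ⊥-elim (y≮x (≤-<-trans (≮⇒≥ z≮y) z<x))

-- Inversions

countBelow : ℕ → List ℕ → ℕ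
countBelow a ys = sum (map ⟦ a >_⟧ ys)

inversions : List ℕ → ℕ
inversions [] = 0
inversions (x ∷ xs) = countBelow x xs + inversions xs

crossInversions : List ℕ → List ℕ → ℕ
crossInversions xs ys = sum (map (λ x → countBelow x ys) xs)

countBelow-++ : ∀ a xs ys → countBelow a (xs ++ ys) ≡ countBelow a xs + countBelow a ys
countBelow-++ a xs ys = trans (cong sum (map-++ ⟦ a >_⟧ xs ys)) (sum-++ (map ⟦ a >_⟧ xs) _)

countBelow-↭ : ∀ a {xs ys} → xs ↭ ys → countBelow a xs ≡ countBelow a ys
countBelow-↭ a xs↭ys = sum-↭ (map⁺ ⟦ a >_⟧ xs↭ys)

countBelow≤length : ∀ a xs → countBelow a xs ≤ length xs
countBelow≤length a [] = z≤n
countBelow≤length a (x ∷ xs) = +-mono-≤ (⟦>⟧≤1 a x) (countBelow≤length a xs)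

countBelow-All≤ : ∀ {a ys} → All (a ≤_) ys → countBelow a ys ≡ 0
countBelow-All≤ [] = refl
countBelow-All≤ (a≤y ∷ a≤ys) = cong₂ _+_ (⟦>⟧-no a≤y) (countBelow-All≤ a≤ys)

countBelow-downFrom : ∀ {a} n → n ≤ a → countBelow a (downFrom n) ≡ n
countBelow-downFrom zero _ = refl
countBelow-downFrom (suc n) n<a = cong₂ _+_ (⟦>⟧-yes n<a) (countBelow-downFrom n (<⇒≤ n<a))

crossInversions-↭ˡ : ∀ {xs ys} zs → xs ↭ ys → crossInversions xs zs ≡ crossInversions ys zs
crossInversions-↭ˡ zs xs↭ys = sum-↭ (map⁺ (λ x → countBelow x zs) xs↭ys)

crossInversions-↭ʳ : ∀ xs {ys zs} → ys ↭ zs → crossInversions xs ys ≡ crossInversions xs zs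
crossInversions-↭ʳ xs ys↭zs = cong sum (map-cong (λ x → countBelow-↭ x ys↭zs) xs)

inversions-++ : ∀ xs ys → inversions (xs ++ ys) ≡ inversions xs + inversions ys + crossInversions xs ys
inversions-++ [] ys = sym (+-identityʳ _)
inversions-++ (x ∷ xs) ys =
  trans (cong₂ _+_ (countBelow-++ x xs ys) (inversions-++ xs ys))
        (regroup (countBelow x xs) (countBelow x ys) (inversions xs) (inversions ys) (crossInversions xs ys))
  where
  regroup : ∀ c d a b e → c + d + (a + b + e) ≡ c + a + b + (d + e)
  regroup = solve-∀

inversions≤length² : ∀ xs → inversions xs ≤ length xs * length xs
inversions≤length² [] = z≤n
inversions≤length² (x ∷ xs) = ≤-trans
  (+-mono-≤ (countBelow≤length x xs) (≤-trans (inversions≤length² xs) (*-monoʳ-≤ (length xs) (n≤1+n _))))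
  (n≤1+n _)

inversions-middle : ∀ ls xs rs → inversions (ls ++ xs ++ rs) ≡
  inversions xs + (inversions ls + inversions rs + crossInversions xs rs + crossInversions ls (xs ++ rs))
inversions-middle ls xs rs = begin
    inversions (ls ++ xs ++ rs)
  ≡⟨ inversions-++ ls (xs ++ rs) ⟩
    inversions ls + inversions (xs ++ rs) + crossInversions ls (xs ++ rs)
  ≡⟨ cong (λ i → inversions ls + i + crossInversions ls (xs ++ rs)) (inversions-++ xs rs) ⟩
    inversions ls + (inversions xs + inversions rs + crossInversions xs rs) + crossInversions ls (xs ++ rs)
  ≡⟨ regroup (inversions ls) (inversions xs) (inversions rs) _ _ ⟩
    inversions xs + (inversions ls + inversions rs + crossInversions xs rs + crossInversions ls (xs ++ rs)) ∎
  where
  open ≡-Reasoning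
  regroup : ∀ a x d c e → a + (x + d + c) + e ≡ x + (a + d + c + e)
  regroup = solve-∀

inversions-↭-middle : ∀ ls {xs ys} rs → xs ↭ ys →
  inversions (ls ++ xs ++ rs) ≤ inversions (ls ++ ys ++ rs) + inversions xs
inversions-↭-middle ls {xs} {ys} rs xs↭ys = begin
    inversions (ls ++ xs ++ rs)
  ≡⟨ inversions-middle ls xs rs ⟩
    inversions xs + outside xs
  ≡⟨ cong₂ (λ c c′ → inversions xs + (inversions ls + inversions rs + c + c′))
       (crossInversions-↭ˡ rs xs↭ys) (crossInversions-↭ʳ ls (++⁺ʳ rs xs↭ys)) ⟩
    inversions xs + outside ys
  ≤⟨ +-monoˡ-≤ (outside ys) (m≤n+m (inversions xs) (inversions ys)) ⟩
    inversions ys + inversions xs + outside ys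
  ≡⟨ regroup (inversions ys) (inversions xs) (outside ys) ⟩
    inversions ys + outside ys + inversions xs
  ≡⟨ cong (_+ inversions xs) (sym (inversions-middle ls ys rs)) ⟩
    inversions (ls ++ ys ++ rs) + inversions xs ∎
  where
  open ≤-Reasoning
  outside : List ℕ → ℕ
  outside zs = inversions ls + inversions rs + crossInversions zs rs + crossInversions ls (zs ++ rs)
  regroup : ∀ a b c → a + b + c ≡ a + c + b
  regroup = solve-∀

inversions-sorted : ∀ {xs} → AllPairs _≤_ xs → inversions xs ≡ 0
inversions-sorted [] = refl
inversions-sorted (x≤xs ∷ sorted) = cong₂ _+_ (countBelow-All≤ x≤xs) (inversions-sorted sorted)

inversions-downFrom : ∀ n → inversions (downFrom n) * 2 + n ≡ n * n
inversions-downFrom zero = refl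
inversions-downFrom (suc n) = begin
    (countBelow n (downFrom n) + inversions (downFrom n)) * 2 + suc n
  ≡⟨ cong (λ c → (c + inversions (downFrom n)) * 2 + suc n) (countBelow-downFrom n ≤-refl) ⟩
    (n + inversions (downFrom n)) * 2 + suc n
  ≡⟨ regroup n (inversions (downFrom n)) ⟩
    (inversions (downFrom n) * 2 + n) + suc (n + n)
  ≡⟨ cong (_+ suc (n + n)) (inversions-downFrom n) ⟩
    n * n + suc (n + n)
  ≡⟨ square-suc n ⟩
    suc n * suc n ∎
  where
  open ≡-Reasoning
  regroup : ∀ n i → (n + i) * 2 + suc n ≡ (i * 2 + n) + suc (n + n)
  regroup = solve-∀
  square-suc : ∀ n → n * n + suc (n + n) ≡ suc n * suc n
  square-suc = solve-∀

n²≤4*inversions-downFrom : ∀ {n} → 2 ≤ n → n * n ≤ 4 * inversions (downFrom n)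
n²≤4*inversions-downFrom {n} 2≤n = +-cancelʳ-≤ (n * n) (n * n) _ (begin
    n * n + n * n
  ≡⟨ cong (λ s → s + s) (sym (inversions-downFrom n)) ⟩
    (I * 2 + n) + (I * 2 + n)
  ≡⟨ regroup I n ⟩
    4 * I + 2 * n
  ≤⟨ +-monoʳ-≤ (4 * I) (*-monoˡ-≤ n 2≤n) ⟩
    4 * I + n * n ∎)
  where
  open ≤-Reasoning
  I = inversions (downFrom n)
  regroup : ∀ i n → (i * 2 + n) + (i * 2 + n) ≡ 4 * i + 2 * n
  regroup = solve-∀

-- Ascending runs

descents : List ℕ → ℕ
descents [] = 0
descents (x ∷ []) = 0
descents (x ∷ y ∷ xs) = ⟦ x > y ⟧ + descents (y ∷ xs)

-- Counts the empty list as one run, so that runs is subadditive on _++_.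
runs : List ℕ → ℕ
runs xs = suc (descents xs)

descents-++ : ∀ xs ys → descents (xs ++ ys) ≤ descents xs + runs ys
descents-++ [] ys = n≤1+n (descents ys)
descents-++ (x ∷ []) [] = z≤n
descents-++ (x ∷ []) (y ∷ ys) = +-monoˡ-≤ (descents (y ∷ ys)) (⟦>⟧≤1 x y)
descents-++ (x ∷ y ∷ xs) ys =
  ≤-trans (+-monoʳ-≤ ⟦ x > y ⟧ (descents-++ (y ∷ xs) ys)) (≤-reflexive (sym (+-assoc ⟦ x > y ⟧ _ _)))

runs-++ : ∀ xs ys → runs (xs ++ ys) ≤ runs xs + runs ys
runs-++ xs ys = s≤s (descents-++ xs ys)

descents-tail : ∀ y ys → descents ys ≤ descents (y ∷ ys)
descents-tail y [] = z≤n
descents-tail y (z ∷ ys) = m≤n+m _ _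

descents-skip : ∀ x y ys → descents (x ∷ ys) ≤ ⟦ x > y ⟧ + descents (y ∷ ys)
descents-skip x y [] = z≤n
descents-skip x y (z ∷ ys) =
  ≤-trans (+-monoˡ-≤ (descents (z ∷ ys)) (⟦>⟧-trans x y z)) (≤-reflexive (+-assoc ⟦ x > y ⟧ _ _))

descents-∷-⊆ : ∀ x {xs ys} → xs ⊆ ys → descents (x ∷ xs) ≤ descents (x ∷ ys)
descents-∷-⊆ x [] = z≤n
descents-∷-⊆ x (_∷ʳ_ {ys = ys} y xs⊆ys) = ≤-trans (descents-∷-⊆ x xs⊆ys) (descents-skip x y ys)
descents-∷-⊆ x (_∷_ {x = y} refl xs⊆ys) = +-monoʳ-≤ ⟦ x > y ⟧ (descents-∷-⊆ y xs⊆ys)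

descents-⊆ : ∀ {xs ys} → xs ⊆ ys → descents xs ≤ descents ys
descents-⊆ [] = z≤n
descents-⊆ (_∷ʳ_ {ys = ys} y xs⊆ys) = ≤-trans (descents-⊆ xs⊆ys) (descents-tail y ys)
descents-⊆ (refl ∷ xs⊆ys) = descents-∷-⊆ _ xs⊆ys

runs-⊆ : ∀ {xs ys} → xs ⊆ ys → runs xs ≤ runs ys
runs-⊆ xs⊆ys = s≤s (descents-⊆ xs⊆ys)

descents-sorted : ∀ {xs} → AllPairs _≤_ xs → descents xs ≡ 0
descents-sorted [] = refl
descents-sorted (_ ∷ []) = refl
descents-sorted ((x≤y ∷ _) ∷ sorted@(_ ∷ _)) = cong₂ _+_ (⟦>⟧-no x≤y) (descents-sorted sorted)

descents-downFrom : ∀ n → descents (downFrom (suc n)) ≡ n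
descents-downFrom zero = refl
descents-downFrom (suc n) = cong₂ _+_ (⟦>⟧-yes ≤-refl) (descents-downFrom n)

n≤runs-downFrom : ∀ n → n ≤ runs (downFrom n)
n≤runs-downFrom zero = z≤n
n≤runs-downFrom (suc n) = ≤-reflexive (cong suc (sym (descents-downFrom n)))

select-⊆ : ∀ bs (xs : List ℕ) → select bs xs ⊆ xs
select-⊆ [] xs = minimum xs
select-⊆ (_ ∷ _) [] = []
select-⊆ (true ∷ bs) (x ∷ xs) = refl ∷ select-⊆ bs xs
select-⊆ (false ∷ bs) (x ∷ xs) = x ∷ʳ select-⊆ bs xs

select++select-not↭ : ∀ bs (xs : List ℕ) → length xs ≤ length bs →
  select bs xs ++ select (map not bs) xs ↭ xs
select++select-not↭ [] [] _ = ↭-refl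
select++select-not↭ (_ ∷ _) [] _ = ↭-refl
select++select-not↭ (true ∷ bs) (x ∷ xs) (s≤s l) = prep x (select++select-not↭ bs xs l)
select++select-not↭ (false ∷ bs) (x ∷ xs) (s≤s l) =
  ↭-trans (shift x (select bs xs) _) (prep x (select++select-not↭ bs xs l))

module Fragments (π : List ℕ) (i k : ℕ) (bs : List Bool) where

  before fragment after selected rest : List ℕ
  before = take i π
  fragment = take k (drop i π)
  after = drop (i + k) π
  selected = select bs fragment
  rest = select (map not bs) fragment

  π≡before++fragment++after : π ≡ before ++ fragment ++ after
  π≡before++fragment++after = sym (begin
      before ++ fragment ++ after
    ≡⟨ cong (λ ds → before ++ fragment ++ ds) (sym (drop-drop i k π)) ⟩
      before ++ fragment ++ drop k (drop i π)
    ≡⟨ cong (before ++_) (take++drop≡id k (drop i π)) ⟩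
      before ++ drop i π
    ≡⟨ take++drop≡id i π ⟩
      π ∎)
    where open ≡-Reasoning

  fragment⊆π : fragment ⊆ π
  fragment⊆π = ⊆-trans (take-⊆ k (drop i π)) (drop-⊆ i π)

  length-fragment≤k : length fragment ≤ k
  length-fragment≤k = ≤-trans (≤-reflexive (length-take k (drop i π))) (m⊓n≤m k _)

inversions-dlApply : ∀ π i k bs → length bs ≡ k → inversions (dlApply π i k bs) ≤ inversions π + k * k
inversions-dlApply π i k bs length-bs = begin
    inversions (before ++ selected ++ rest ++ after)
  ≡⟨ cong (λ ys → inversions (before ++ ys)) (sym (++-assoc selected rest after)) ⟩
    inversions (before ++ (selected ++ rest) ++ after)
  ≤⟨ inversions-↭-middle before after reordered ⟩
    inversions (before ++ fragment ++ after) + inversions (selected ++ rest)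
  ≤⟨ +-mono-≤ (≤-reflexive (cong inversions (sym π≡before++fragment++after)))
               (inversions≤length² (selected ++ rest)) ⟩
    inversions π + length (selected ++ rest) * length (selected ++ rest)
  ≤⟨ +-monoʳ-≤ (inversions π) (*-mono-≤ length≤k length≤k) ⟩
    inversions π + k * k ∎
  where
  open Fragments π i k bs
  open ≤-Reasoning
  reordered : selected ++ rest ↭ fragment
  reordered = select++select-not↭ bs fragment (subst (length fragment ≤_) (sym length-bs) length-fragment≤k)
  length≤k : length (selected ++ rest) ≤ k
  length≤k = ≤-trans (≤-reflexive (↭-length reordered)) length-fragment≤k

runs-dlApply : ∀ π i k bs → runs (dlApply π i k bs) ≤ 4 * runs π
runs-dlApply π i k bs = begin
    runs (before ++ selected ++ rest ++ after)
  ≤⟨ runs-++ before _ ⟩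
    runs before + runs (selected ++ rest ++ after)
  ≤⟨ +-monoʳ-≤ (runs before) (≤-trans (runs-++ selected _) (+-monoʳ-≤ (runs selected) (runs-++ rest after))) ⟩
    runs before + (runs selected + (runs rest + runs after))
  ≤⟨ +-mono-≤ (runs-⊆ (take-⊆ i π)) (+-mono-≤ (runs-⊆ (⊆-trans (select-⊆ bs fragment) fragment⊆π))
       (+-mono-≤ (runs-⊆ (⊆-trans (select-⊆ (map not bs) fragment) fragment⊆π)) (runs-⊆ (drop-⊆ (i + k) π)))) ⟩
    runs π + (runs π + (runs π + runs π))
  ≡⟨ four-times (runs π) ⟩
    4 * runs π ∎
  where
  open Fragments π i k bs
  open ≤-Reasoning
  four-times : ∀ r → r + (r + (r + r)) ≡ 4 * r
  four-times = solve-∀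

inversions-DLSteps : ∀ {K m π σ} → DLSteps K m π σ → inversions σ ≤ inversions π + m * (K * K)
inversions-DLSteps {π = π} done = m≤m+n (inversions π) 0
inversions-DLSteps {K} {suc m} {π} {σ} (step (i , k , bs , k≤K , _ , length-bs , refl) steps) = begin
    inversions σ
  ≤⟨ inversions-DLSteps steps ⟩
    inversions (dlApply π i k bs) + m * (K * K)
  ≤⟨ +-monoˡ-≤ (m * (K * K)) (inversions-dlApply π i k bs length-bs) ⟩
    inversions π + k * k + m * (K * K)
  ≤⟨ +-monoˡ-≤ (m * (K * K)) (+-monoʳ-≤ (inversions π) (*-mono-≤ k≤K k≤K)) ⟩
    inversions π + K * K + m * (K * K)
  ≡⟨ +-assoc (inversions π) (K * K) _ ⟩
    inversions π + suc m * (K * K) ∎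
  where open ≤-Reasoning

runs-DLSteps : ∀ {K m π σ} → DLSteps K m π σ → runs σ ≤ 4 ^ m * runs π
runs-DLSteps {π = π} done = ≤-reflexive (sym (+-identityʳ (runs π)))
runs-DLSteps {m = suc m} {π} {σ} (step (i , k , bs , _ , _ , _ , refl) steps) = begin
    runs σ
  ≤⟨ runs-DLSteps steps ⟩
    4 ^ m * runs (dlApply π i k bs)
  ≤⟨ *-monoʳ-≤ (4 ^ m) (runs-dlApply π i k bs) ⟩
    4 ^ m * (4 * runs π)
  ≡⟨ regroup (4 ^ m) (runs π) ⟩
    4 ^ suc m * runs π ∎
  where
  open ≤-Reasoning
  regroup : ∀ p r → p * (4 * r) ≡ 4 * p * r
  regroup = solve-∀

downFrom↭upTo : ∀ n → downFrom n ↭ upTo n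
downFrom↭upTo n = subst (_↭ upTo n) (reverse-upTo n) (↭-reverse (upTo n))

sorted-upTo : ∀ n → AllPairs _≤_ (upTo n)
sorted-upTo n = AllPairs.applyUpTo⁺₁ id n (λ i<j _ → <⇒≤ i<j)

⌊log₂⌋≤2* : ∀ {n} m → n ≤ 4 ^ m → ⌊log₂ n ⌋ ≤ 2 * m
⌊log₂⌋≤2* {n} m n≤4^m = subst (⌊log₂ n ⌋ ≤_) (⌊log₂[2^n]⌋≡n (2 * m))
  (⌊log₂⌋-mono-≤ (subst (n ≤_) (^-*-assoc 2 2 m) n≤4^m))

proposition5 : (K : ℕ → ℕ) → (∀ n → 2 ≤ K n) →
    ∃ λ C → ∃ λ N → ∀ n → N ≤ n →
      ∃ λ (σ : List ℕ) → (σ ↭ upTo n) ×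
        (∀ m → DLSteps (K n) m (upTo n) σ →
          ⌊log₂ n ⌋ * (K n * K n) + n * n ≤ C * m * (K n * K n))
proposition5 K _ = 6 , 2 , λ n 2≤n → downFrom n , downFrom↭upTo n , reversal-bound n 2≤n
  where
  reversal-bound : ∀ n → 2 ≤ n → ∀ m → DLSteps (K n) m (upTo n) (downFrom n) →
    ⌊log₂ n ⌋ * (K n * K n) + n * n ≤ 6 * m * (K n * K n)
  reversal-bound n 2≤n m steps = begin
      ⌊log₂ n ⌋ * KK + n * n
    ≤⟨ +-mono-≤ (*-monoˡ-≤ KK (⌊log₂⌋≤2* m n≤4^m))
                (≤-trans (n²≤4*inversions-downFrom 2≤n) (*-monoʳ-≤ 4 inversions≤mKK)) ⟩
      2 * m * KK + 4 * (m * KK)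
    ≡⟨ collect m KK ⟩
      6 * m * KK ∎
    where
    open ≤-Reasoning
    KK = K n * K n
    inversions≤mKK : inversions (downFrom n) ≤ m * KK
    inversions≤mKK = subst (λ i → inversions (downFrom n) ≤ i + m * KK)
      (inversions-sorted (sorted-upTo n)) (inversions-DLSteps steps)
    n≤4^m : n ≤ 4 ^ m
    n≤4^m = begin
        n
      ≤⟨ n≤runs-downFrom n ⟩
        runs (downFrom n)
      ≤⟨ runs-DLSteps steps ⟩
        4 ^ m * runs (upTo n)
      ≡⟨ cong (4 ^ m *_) (cong suc (descents-sorted (sorted-upTo n))) ⟩
        4 ^ m * 1
      ≡⟨ *-identityʳ (4 ^ m) ⟩
        4 ^ m ∎
    collect : ∀ m k → 2 * m * k + 4 * (m * k) ≡ 6 * m * k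
    collect = solve-∀
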